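{- Let $0\le k\le n$ and let $Y$ be a Young diagram of shape $\lambda=(\lambda_1,\ldots,\lambda_k)$ contained in the $k\times(n-k)$ rectangle. There is a bijection $C\mapsto T$ from the set of Catalan paths of size $(n,k)$ constrained by $Y$ to the set of Catalan alternative tableaux of size $(n,k)$ whose Young diagram is $Y$ (equivalently, whose type $\tau$ satisfies $\lambda(\tau)=\lambda$), such that $\mathrm{wt}(C)=\mathrm{wt}(T)$.
   Context: Young diagrams are in English convention, justified to the northwest corner of a rectangle with $k$ rows and $n-k$ columns; row $i$ (from the top) has $\lambda_i$ boxes, $\lambda_1\ge\cdots\ge\lambda_k\ge0$. The boundary path of $Y$ is the lattice path of south and west unit steps from the northeast corner to the southwest corner of the rectangle that follows the southeast border of $Y$ (including, where $Y$ is shorter than the rectangle, portions along the top or left border of the rectangle). A Catalan alternative tableau $T$ of size $(n,k)$ is such a Young diagram $Y$ together with a filling of some boxes of $Y$ with $\alpha$ and $\beta$ such that: (i) every box of $Y$ in the same column as and above an $\alpha$ is empty; (ii) every box of $Y$ in the same row as and to the left of a $\beta$ is empty; (iii) every box of $Y$ that is neither above an $\alpha$ nor to the left of a $\beta$ contains an $\alpha$ or a $\beta$. Its type is the word obtained by reading the boundary path from northeast to southwest, writing $1$ for a south step and $0$ for a west step; $\lambda(\tau)=(\lambda_1,\dots,\lambda_k)$ where $\lambda_i$ is the number of $0$'s after the $i$-th $1$ of $\tau$. Its weight is $\mathrm{wt}(T)=(\alpha\beta)^n\alpha^{ -f_{\mathrm{col}}(T)}\beta^{ -f_{\mathrm{row}}(T)}$,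 where $f_{\mathrm{col}}(T)$ is the number of columns of the rectangle containing no $\alpha$ and $f_{\mathrm{row}}(T)$ is the number of rows of the rectangle containing no $\beta$. A Catalan path of size $(n,k)$ constrained by $Y$ is a lattice path of south and west unit steps from the northeast corner to the southwest corner of the $k\times(n-k)$ rectangle that never crosses the boundary path of $Y$ (i.e. stays weakly northwest of it), with edge weights: a south step lying on the west border of the rectangle has weight $1/\beta$; any other south step has weight $1$; a west step that coincides with a west step of the boundary path of $Y$ has weight $1/\alpha$; any other west step has weight $1$. The path weight $\mathrm{pwt}(C)$ is the product of its edge weights, and $\mathrm{wt}(C)=(\alpha\beta)^n\,\mathrm{pwt}(C)$. -}

module Defs where

open import Data.Nat using (ℕ; zero; suc; _+_; _∸_; _≤_; _<_; _≡ᵇ_)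
open import Data.Bool using (Bool; true; false; _∧_; _∨_; not; if_then_else_)
open import Data.Integer using (ℤ; +_; _-_)
open import Data.Fin using (Fin; toℕ)
open import Data.Vec using (Vec; []; _∷_; lookup; allFin; toList)
import Data.Vec as V
open import Data.List using (List; []; _∷_; _++_; replicate; take; length)
import Data.List as L
open import Data.Product using (Σ; _×_; _,_; proj₁)
open import Data.Unit using (⊤)
open import Relation.Binary.PropositionalEquality using (_≡_; _≢_)

-- Young diagrams in a k × m rectangle (m = n - k), English convention.
-- A shape is a vector (λ₁,…,λ_k) with m ≥ λ₁ ≥ λ₂ ≥ … ≥ λ_k ≥ 0.

YoungIn : ℕ → {k : ℕ} → Vec ℕ k → Set
YoungIn m []       = ⊤
YoungIn m (x ∷ xs) = x ≤ m × YoungIn x xs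

-- box (i , j) (row i, column j, 0-indexed from the NW corner) belongs to Y
InY : {k m : ℕ} → Vec ℕ k → Fin k → Fin m → Set
InY la i j = toℕ j < lookup la i

-- Lattice paths: words in S (south, letter 1) and W (west, letter 0)

data Step : Set where
  S W : Step

isS : Step → Bool
isS S = true
isS W = false

isW : Step → Bool
isW s = not (isS s)

countS : List Step → ℕ
countS ws = length (L.filter (λ s → Data.Bool.T? (isS s)) ws)
  where import Data.Bool

countW : List Step → ℕ
countW ws = length (L.filter (λ s → Data.Bool.T? (isW s)) ws)
  where import Data.Bool

-- Boundary path of Y, read from the NE corner to the SW corner:
-- 0^{m-λ₁} 1 0^{λ₁-λ₂} 1 … 1 0^{λ_k}   (so λ_i = number of 0's after the i-th 1)
boundaryFrom : ℕ → List ℕ → List Step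
boundaryFrom cur []       = replicate cur W
boundaryFrom cur (x ∷ xs) = replicate (cur ∸ x) W ++ (S ∷ boundaryFrom x xs)

boundary : (m : ℕ) {k : ℕ} → Vec ℕ k → List Step
boundary m la = boundaryFrom m (toList la)

-- A Catalan path of size (n,k) constrained by Y: k south and n-k west steps,
-- staying weakly northwest of the boundary path of Y (after every prefix of
-- length t, the path has made at most as many south steps as the boundary).
IsCatalanPath : (n k : ℕ) → Vec ℕ k → List Step → Set
IsCatalanPath n k la p =
  countS p ≡ k × countW p ≡ n ∸ k ×
  ((t : ℕ) → countS (take t p) ≤ countS (take t (boundary (n ∸ k) la)))

CatalanPath : (n k : ℕ) → Vec ℕ k → Set
CatalanPath n k la = Σ (List Step) (IsCatalanPath n k la)

-- Edges of a path started at the NE corner (x = m, y = 0);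
-- x = column coordinate (0 = west border), y = number of south steps taken.
-- (S , x , y): vertical edge from (x,y) to (x,y+1);
-- (W , x , y): horizontal edge from (x,y) to (x-1,y).
Edge : Set
Edge = Step × ℕ × ℕ

edgesFrom : ℕ → ℕ → List Step → List Edge
edgesFrom x y []       = []
edgesFrom x y (S ∷ ws) = (S , x , y) ∷ edgesFrom x (suc y) ws
edgesFrom x y (W ∷ ws) = (W , x , y) ∷ edgesFrom (x ∸ 1) y ws

sameEdge : Edge → Edge → Bool
sameEdge (S , x , y) (S , x' , y') = (x ≡ᵇ x') ∧ (y ≡ᵇ y')
sameEdge (W , x , y) (W , x' , y') = (x ≡ᵇ x') ∧ (y ≡ᵇ y')
sameEdge _ _ = false

elemEdge : Edge → List Edge → Bool
elemEdge e []       = false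
elemEdge e (f ∷ fs) = sameEdge e f ∨ elemEdge e fs

countB : {A : Set} → (A → Bool) → List A → ℕ
countB P []       = 0
countB P (x ∷ xs) = (if P x then 1 else 0) + countB P xs

-- south steps on the west border (weight 1/β)
betaSteps : ℕ → List Step → ℕ
betaSteps m p = countB (λ { (S , x , _) → x ≡ᵇ 0 ; (W , _ , _) → false }) (edgesFrom m 0 p)

-- west steps coinciding with a west step of the boundary path (weight 1/α)
alphaSteps : ℕ → {k : ℕ} → Vec ℕ k → List Step → ℕ
alphaSteps m la p =
  countB (λ { (S , _ , _) → false ; e@(W , _ , _) → elemEdge e (edgesFrom m 0 (boundary m la)) })
         (edgesFrom m 0 p)

-- Laurent monomials α^a β^b represented by their exponent pair (a , b).
Monomial : Set
Monomial = ℤ × ℤ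

-- wt(C) = (αβ)^n pwt(C) = α^{n - #alphaSteps} β^{n - #betaSteps}
wtPath : (n k : ℕ) (la : Vec ℕ k) → CatalanPath n k la → Monomial
wtPath n k la (p , _) = (+ n - + alphaSteps (n ∸ k) la p , + n - + betaSteps (n ∸ k) p)

data Cell : Set where
  empty α β : Cell

Filling : ℕ → ℕ → Set
Filling k m = Vec (Vec Cell m) k

cell : {k m : ℕ} → Filling k m → Fin k → Fin m → Cell
cell F i j = lookup (lookup F i) j

IsCatalanTableau : {k m : ℕ} → Vec ℕ k → Filling k m → Set
IsCatalanTableau {k} {m} la F =
  ((i : Fin k) (j : Fin m) → (InY la i j → Data.Empty.⊥) → cell F i j ≡ empty) ×
  ((i : Fin k) (j : Fin m) → cell F i j ≡ α →
     (i' : Fin k) → toℕ i' < toℕ i → InY la i' j → cell F i' j ≡ empty) ×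
  ((i : Fin k) (j : Fin m) → cell F i j ≡ β →
     (j' : Fin m) → toℕ j' < toℕ j → InY la i j' → cell F i j' ≡ empty) ×
  ((i : Fin k) (j : Fin m) → InY la i j →
     ((i' : Fin k) → toℕ i < toℕ i' → cell F i' j ≢ α) →
     ((j' : Fin m) → toℕ j < toℕ j' → cell F i j' ≢ β) →
     cell F i j ≢ empty)
  where import Data.Empty

CatalanTableau : (n k : ℕ) → Vec ℕ k → Set
CatalanTableau n k la = Σ (Filling k (n ∸ k)) (IsCatalanTableau la)

isα : Cell → Bool
isα α = true
isα _ = false

isβ : Cell → Bool
isβ β = true
isβ _ = false

anyV : {l : ℕ} → (Fin l → Bool) → Bool
anyV P = L.foldr _∨_ false (toList (V.map P (allFin _)))

fcol : {k m : ℕ} → Filling k m → ℕ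
fcol {k} {m} F = countB (λ j → not (anyV (λ i → isα (cell F i j)))) (toList (allFin m))

frow : {k m : ℕ} → Filling k m → ℕ
frow {k} {m} F = countB (λ i → not (anyV (λ j → isβ (cell F i j)))) (toList (allFin k))

wtTableau : (n k : ℕ) (la : Vec ℕ k) → CatalanTableau n k la → Monomial
wtTableau n k la (F , _) = (+ n - + fcol F , + n - + frow F)

-- Read the path from the northeast corner, keeping track of the live rows of the current column:
-- the rows of Y that reach it and have not yet received a β. A west step puts an α in the lowest
-- live row of the column it crosses; a south step puts a β in the lowest live row of the column to
-- its west and retires that row. The filling obtained satisfies (i)–(iii), and conversely every
-- Catalan alternative tableau is taken apart column by column from the east, inverting the
-- construction. Live rows plus south steps taken always add up to the height of the column, so a
-- south step finds a live row exactly when the path stays above the boundary, a column receives no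
-- α exactly when the path crosses it along the boundary, and the rows without β are as many as the
-- south steps on the west border.
module Submission where

open import Defs
open import Data.Nat using (ℕ; zero; suc; _+_; _∸_; _≤_; _<_; _<ᵇ_; _≡ᵇ_; _≟_; _<?_; z≤n; s≤s; z<s; s<s; s≤s⁻¹; s<s⁻¹)
open import Data.Nat.Properties
open import Data.Bool using (Bool; true; false; T; _∧_; _∨_; not; if_then_else_)
open import Data.Bool.Properties using (∨-identityʳ; ∨-assoc; ∨-zeroʳ; not-¬)
open import Data.Maybe using (Maybe; just; nothing; is-nothing)
open import Data.Fin using (Fin; toℕ; fromℕ<)
open import Data.Fin.Properties using (toℕ<n; fromℕ<-toℕ; toℕ-fromℕ<)
open import Data.Vec using (Vec; []; _∷_; lookup; tabulate; toList; map)
open import Data.Vec.Properties using (lookup∘tabulate; tabulate∘lookup; tabulate-cong; length-toList)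
open import Data.List using (List; []; _∷_; length; take; replicate; foldr)
open import Data.Product using (Σ; ∃; _×_; _,_; proj₁; proj₂)
open import Data.Empty using (⊥; ⊥-elim)
open import Data.Unit using (⊤; tt)
import Data.Integer as ℤ
open import Relation.Binary using (tri<; tri≈; tri>)
open import Relation.Binary.PropositionalEquality
open import Relation.Nullary using (¬_; yes; no)
open import Relation.Nullary.Decidable using (dec-true; dec-false)
open import Function.Bundles using (_⇔_; mk⇔; Equivalence)
import Function.Properties.Equivalence as ⇔

α≢β : α ≢ β
α≢β ()

β≢α : β ≢ α
β≢α ()

β≢empty : β ≢ empty
β≢empty ()

empty≢α : empty ≢ α
empty≢α ()

indicator : Bool → ℕ
indicator b = if b then 1 else 0

countBelow : ℕ → (ℕ → Bool) → ℕ
countBelow zero Q = 0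
countBelow (suc k) Q = indicator (Q 0) + countBelow k (λ i → Q (suc i))

anyBelow : ℕ → (ℕ → Bool) → Bool
anyBelow zero Q = false
anyBelow (suc k) Q = Q 0 ∨ anyBelow k (λ i → Q (suc i))

findLast : ℕ → (ℕ → Bool) → Maybe ℕ
findLast zero P = nothing
findLast (suc k) P = if P k then just k else findLast k P

countBelow-cong : ∀ k (Q Q' : ℕ → Bool) → (∀ i → i < k → Q i ≡ Q' i) → countBelow k Q ≡ countBelow k Q'
countBelow-cong zero Q Q' h = refl
countBelow-cong (suc k) Q Q' h = cong₂ _+_ (cong indicator (h 0 z<s)) (countBelow-cong k _ _ (λ i lt → h (suc i) (s<s lt)))

anyBelow-cong : ∀ k (Q Q' : ℕ → Bool) → (∀ i → i < k → Q i ≡ Q' i) → anyBelow k Q ≡ anyBelow k Q'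
anyBelow-cong zero Q Q' h = refl
anyBelow-cong (suc k) Q Q' h = cong₂ _∨_ (h 0 z<s) (anyBelow-cong k _ _ (λ i lt → h (suc i) (s<s lt)))

countBelow-last : ∀ k Q → countBelow (suc k) Q ≡ countBelow k Q + indicator (Q k)
countBelow-last zero Q = +-comm (indicator (Q 0)) 0
countBelow-last (suc k) Q = trans (cong (indicator (Q 0) +_) (countBelow-last k (λ i → Q (suc i))))
  (sym (+-assoc (indicator (Q 0)) _ _))

anyBelow-last : ∀ k Q → anyBelow (suc k) Q ≡ anyBelow k Q ∨ Q k
anyBelow-last zero Q = ∨-identityʳ (Q 0)
anyBelow-last (suc k) Q = trans (cong (Q 0 ∨_) (anyBelow-last k (λ i → Q (suc i)))) (sym (∨-assoc (Q 0) _ _))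

countBelow-true : ∀ k → countBelow k (λ _ → true) ≡ k
countBelow-true zero = refl
countBelow-true (suc k) = cong suc (countBelow-true k)

countBelow-≤ : ∀ k Q → countBelow k Q ≤ k
countBelow-≤ zero Q = z≤n
countBelow-≤ (suc k) Q with Q 0
... | true = s≤s (countBelow-≤ k _)
... | false = m≤n⇒m≤1+n (countBelow-≤ k _)

countBelow-none : ∀ k Q → (∀ i → i < k → Q i ≡ false) → countBelow k Q ≡ 0
countBelow-none zero Q h = refl
countBelow-none (suc k) Q h rewrite h 0 z<s = countBelow-none k _ (λ i lt → h (suc i) (s<s lt))

countBelow-pos : ∀ k Q i → i < k → Q i ≡ true → 0 < countBelow k Q
countBelow-pos (suc k) Q zero lt e rewrite e = s≤s z≤n
countBelow-pos (suc k) Q (suc i) lt e = ≤-trans (countBelow-pos k _ i (s<s⁻¹ lt) e) (m≤n+m _ (indicator (Q 0)))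

countBelow-flip : ∀ k Q Q' b → b < k → (∀ i → i < k → i ≢ b → Q i ≡ Q' i) → Q b ≡ false → Q' b ≡ true →
  countBelow k Q + 1 ≡ countBelow k Q'
countBelow-flip (suc k) Q Q' zero lt h e e' rewrite e | e' =
  trans (+-comm (countBelow k _) 1) (cong suc (countBelow-cong k _ _ (λ i lt' → h (suc i) (s<s lt') (λ ()))))
countBelow-flip (suc k) Q Q' (suc b) lt h e e' =
  trans (+-assoc (indicator (Q 0)) _ 1)
   (cong₂ _+_ (cong indicator (h 0 z<s (λ ())))
     (countBelow-flip k _ _ b (s<s⁻¹ lt) (λ i lt' ne → h (suc i) (s<s lt') (λ q → ne (suc-injective q))) e e'))

anyBelow-true : ∀ l Q j → j < l → Q j ≡ true → anyBelow l Q ≡ true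
anyBelow-true (suc l) Q zero lt e rewrite e = refl
anyBelow-true (suc l) Q (suc j) lt e = trans (cong (Q 0 ∨_) (anyBelow-true l (λ i → Q (suc i)) j (s<s⁻¹ lt) e)) (∨-zeroʳ (Q 0))

anyBelow-false : ∀ l Q → (∀ j → j < l → Q j ≡ false) → anyBelow l Q ≡ false
anyBelow-false zero Q h = refl
anyBelow-false (suc l) Q h rewrite h 0 z<s = anyBelow-false l _ (λ j lt → h (suc j) (s<s lt))

findLast-just : ∀ k P b → findLast k P ≡ just b → b < k × P b ≡ true × (∀ i → b < i → i < k → P i ≡ false)
findLast-just zero P b ()
findLast-just (suc k) P b e with P k in pk
... | true with e
... | refl = n<1+n b , pk , λ i bi ik → ⊥-elim (<⇒≱ bi (s≤s⁻¹ ik))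
findLast-just (suc k) P b e | false with findLast-just k P b e
... | (bk , pb , hi) = m≤n⇒m≤1+n bk , pb , above
  where
  above : ∀ i → b < i → i < suc k → P i ≡ false
  above i bi ik with i ≟ k
  ... | yes refl = pk
  ... | no ne = hi i bi (≤∧≢⇒< (s≤s⁻¹ ik) ne)

findLast-nothing : ∀ k P → findLast k P ≡ nothing → ∀ i → i < k → P i ≡ false
findLast-nothing (suc k) P e i lt with P k in pk
findLast-nothing (suc k) P () i lt | true
... | false with i ≟ k
... | yes refl = pk
... | no ne = findLast-nothing k P e i (≤∧≢⇒< (s≤s⁻¹ lt) ne)

<ᵇ-true : ∀ {m n} → m < n → (m <ᵇ n) ≡ true
<ᵇ-true {m} {n} = dec-true (m <? n)

<ᵇ-false : ∀ {m n} → n ≤ m → (m <ᵇ n) ≡ false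
<ᵇ-false {m} {n} n≤m = dec-false (m <? n) (≤⇒≯ n≤m)

<ᵇ-true⁻¹ : ∀ {m n} → (m <ᵇ n) ≡ true → m < n
<ᵇ-true⁻¹ {m} {n} e = <ᵇ⇒< m n (subst T (sym e) _)

<ᵇ-false⁻¹ : ∀ {m n} → (m <ᵇ n) ≡ false → n ≤ m
<ᵇ-false⁻¹ {m} {n} e = ≮⇒≥ (λ lt → subst T e (<⇒<ᵇ lt))

≡ᵇ-true : ∀ {m n} → m ≡ n → (m ≡ᵇ n) ≡ true
≡ᵇ-true {m} {n} = dec-true (m ≟ n)

≡ᵇ-false : ∀ {m n} → m ≢ n → (m ≡ᵇ n) ≡ false
≡ᵇ-false {m} {n} = dec-false (m ≟ n)

countAbove : ℕ → List ℕ → ℕ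
countAbove j [] = 0
countAbove j (e ∷ es) = indicator (j <ᵇ e) + countAbove j es

YoungListIn : ℕ → List ℕ → Set
YoungListIn m [] = ⊤
YoungListIn m (x ∷ xs) = x ≤ m × YoungListIn x xs

indicator-anti : ∀ {j j' e} → j ≤ j' → indicator (j' <ᵇ e) ≤ indicator (j <ᵇ e)
indicator-anti {j} {j'} {e} le with j' <ᵇ e in q
... | false = z≤n
... | true rewrite <ᵇ-true {j} {e} (≤-<-trans le (<ᵇ-true⁻¹ q)) = ≤-refl

countAbove-anti : ∀ {j j'} xs → j ≤ j' → countAbove j' xs ≤ countAbove j xs
countAbove-anti [] le = z≤n
countAbove-anti (e ∷ xs) le = +-mono-≤ (indicator-anti {e = e} le) (countAbove-anti xs le)

youngListIn-weaken : ∀ {e c} xs → e ≤ c → YoungListIn e xs → YoungListIn c xs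
youngListIn-weaken [] le y = tt
youngListIn-weaken (x ∷ xs) le (l , r) = ≤-trans l le , r

countAbove-zero : ∀ c xs → YoungListIn c xs → countAbove c xs ≡ 0
countAbove-zero c [] _ = refl
countAbove-zero c (e ∷ xs) (le , young) rewrite <ᵇ-false {c} {e} le = countAbove-zero c xs (youngListIn-weaken xs le young)

countAbove-hit : ∀ j c xs → j < c → countAbove j (c ∷ xs) ≡ suc (countAbove j xs)
countAbove-hit j c xs lt rewrite <ᵇ-true lt = refl

boundaryFrom-S : ∀ c xs → boundaryFrom c (c ∷ xs) ≡ S ∷ boundaryFrom c xs
boundaryFrom-S c xs rewrite n∸n≡0 c = refl

boundaryFrom-W : ∀ c x1 xs → x1 ≤ c → boundaryFrom (suc c) (x1 ∷ xs) ≡ W ∷ boundaryFrom c (x1 ∷ xs)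
boundaryFrom-W c x1 xs le rewrite +-∸-assoc 1 le = refl

module Construction (k : ℕ) where

  -- fill m L p reads p with m columns left to its west. L i is the length of row i, reset to 0 once
  -- the row has received its β; row i is live in column j when j < L i.
  live : ℕ → (ℕ → ℕ) → ℕ → Bool
  live m L i = m <ᵇ L i

  retire : (ℕ → ℕ) → ℕ → ℕ → ℕ
  retire L b i = if i ≡ᵇ b then 0 else L i

  αAt : Maybe ℕ → ℕ → Cell
  αAt nothing i = empty
  αAt (just b) i = if i ≡ᵇ b then α else empty

  withColumn : ℕ → Maybe ℕ → (ℕ → ℕ → Cell) → ℕ → ℕ → Cell
  withColumn m fb h' i j = if j ≡ᵇ m then αAt fb i else h' i j

  put : ℕ → ℕ → Cell → (ℕ → ℕ → Cell) → ℕ → ℕ → Cell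
  put b m c h i j = if (i ≡ᵇ b) ∧ (j ≡ᵇ m) then c else h i j

  put-hit : ∀ b m c h → put b m c h b m ≡ c
  put-hit b m c h rewrite ≡ᵇ-true {b} refl | ≡ᵇ-true {m} refl = refl

  put-otherRow : ∀ b m c h i j → i ≢ b → put b m c h i j ≡ h i j
  put-otherRow b m c h i j ne rewrite ≡ᵇ-false ne = refl

  put-otherColumn : ∀ b m c h i j → j ≢ m → put b m c h i j ≡ h i j
  put-otherColumn b m c h i j ne rewrite ≡ᵇ-false ne with i ≡ᵇ b
  ... | true = refl
  ... | false = refl

  mutual
    fill : ℕ → (ℕ → ℕ) → List Step → ℕ → ℕ → Cell
    fill zero L p i j = empty
    fill (suc m) L [] i j = empty
    fill (suc m) L (W ∷ p) = withColumn m (findLast k (live m L)) (fill m L p)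
    fill (suc m) L (S ∷ p) = fillS m L p (findLast k (live m L))

    fillS : ℕ → (ℕ → ℕ) → List Step → Maybe ℕ → ℕ → ℕ → Cell
    fillS m L p nothing i j = empty
    fillS m L p (just b) = put b m β (fill (suc m) (retire L b) p)

  mutual
    Fits : ℕ → (ℕ → ℕ) → List Step → Set
    Fits zero L p = ⊤
    Fits (suc m) L [] = ⊥
    Fits (suc m) L (W ∷ p) = Fits m L p
    Fits (suc m) L (S ∷ p) = FitsS m L p (findLast k (live m L))

    FitsS : ℕ → (ℕ → ℕ) → List Step → Maybe ℕ → Set
    FitsS m L p nothing = ⊥
    FitsS m L p (just b) = Fits (suc m) (retire L b) p

  record IsTableau (m : ℕ) (L : ℕ → ℕ) (h : ℕ → ℕ → Cell) : Set where
    field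
      empty-outside : ∀ i j → i < k → j < m → L i ≤ j → h i j ≡ empty
      empty-above-α : ∀ i j i' → i < k → j < m → h i j ≡ α → i' < i → j < L i' → h i' j ≡ empty
      empty-left-of-β : ∀ i j j' → i < k → j < m → h i j ≡ β → j' < j → j' < L i → h i j' ≡ empty
      free-nonempty : ∀ i j → i < k → j < m → j < L i →
             (∀ i' → i < i' → i' < k → h i' j ≢ α) →
             (∀ j' → j < j' → j' < m → h i j' ≢ β) → h i j ≢ empty
  open IsTableau

  withColumn-last : ∀ m fb h' i → withColumn m fb h' i m ≡ αAt fb i
  withColumn-last m fb h' i rewrite ≡ᵇ-true {m} refl = refl

  withColumn-other : ∀ m fb h' i j → j ≢ m → withColumn m fb h' i j ≡ h' i j
  withColumn-other m fb h' i j ne rewrite ≡ᵇ-false ne = refl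

  αAt-hit : ∀ b → αAt (just b) b ≡ α
  αAt-hit b rewrite ≡ᵇ-true {b} refl = refl

  αAt-miss : ∀ b i → i ≢ b → αAt (just b) i ≡ empty
  αAt-miss b i ne rewrite ≡ᵇ-false ne = refl

  αAt-≢β : ∀ fb i → αAt fb i ≢ β
  αAt-≢β nothing i ()
  αAt-≢β (just b) i e with i ≡ᵇ b
  αAt-≢β (just b) i () | true
  αAt-≢β (just b) i () | false

  αAt-α : ∀ fb i → αAt fb i ≡ α → fb ≡ just i
  αAt-α nothing i ()
  αAt-α (just b) i e with i ≡ᵇ b in q
  ... | true = cong just (sym (≡ᵇ⇒≡ i b (subst T (sym q) _)))
  αAt-α (just b) i () | false

  retire-hit : ∀ L b → retire L b b ≡ 0
  retire-hit L b rewrite ≡ᵇ-true {b} refl = refl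

  retire-miss : ∀ L b i → i ≢ b → retire L b i ≡ L i
  retire-miss L b i ne rewrite ≡ᵇ-false ne = refl

  αAt-notLive : ∀ m L fb i → findLast k (live m L) ≡ fb → L i ≤ m → αAt fb i ≡ empty
  αAt-notLive m L nothing i eq Li≤m = refl
  αAt-notLive m L (just b) i eq Li≤m with i ≟ b
  ... | no ne = αAt-miss b i ne
  ... | yes refl = ⊥-elim (<⇒≱ (<ᵇ-true⁻¹ (proj₁ (proj₂ (findLast-just k _ b eq)))) Li≤m)

  αAt-live : ∀ m L fb i → findLast k (live m L) ≡ fb → i < k → m < L i →
             (∀ i' → i < i' → i' < k → αAt fb i' ≢ α) → αAt fb i ≢ empty
  αAt-live m L nothing i eq ik m<Li noα = ⊥-elim (not-¬ (<ᵇ-true m<Li) (findLast-nothing k _ eq i ik))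
  αAt-live m L (just b) i eq ik m<Li noα with <-cmp i b
  ... | tri≈ _ refl _ = λ e → empty≢α (trans (sym e) (αAt-hit i))
  ... | tri> _ _ b<i = ⊥-elim (not-¬ (<ᵇ-true m<Li) (proj₂ (proj₂ (findLast-just k _ b eq)) i b<i ik))
  ... | tri< i<b _ _ = ⊥-elim (noα b i<b (proj₁ (findLast-just k _ b eq)) (αAt-hit b))

  withColumn-isTableau : ∀ m L fb h' → findLast k (live m L) ≡ fb → IsTableau m L h' → IsTableau (suc m) L (withColumn m fb h')
  empty-outside (withColumn-isTableau m L fb h' eq C) i j ik jm Lij with j ≟ m
  ... | yes refl = trans (withColumn-last m fb h' i) (αAt-notLive m L fb i eq Lij)
  ... | no ne = trans (withColumn-other m fb h' i j ne) (empty-outside C i j ik (≤∧≢⇒< (s≤s⁻¹ jm) ne) Lij)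
  empty-above-α (withColumn-isTableau m L fb h' eq C) i j i' ik jm hα i'i jL with j ≟ m
  ... | yes refl = trans (withColumn-last m fb h' i') (subst (λ z → αAt z i' ≡ empty) (sym e) (αAt-miss i i' (<⇒≢ i'i)))
    where e : fb ≡ just i
          e = αAt-α fb i (trans (sym (withColumn-last m fb h' i)) hα)
  ... | no ne = trans (withColumn-other m fb h' i' j ne)
                      (empty-above-α C i j i' ik (≤∧≢⇒< (s≤s⁻¹ jm) ne) (trans (sym (withColumn-other m fb h' i j ne)) hα) i'i jL)
  empty-left-of-β (withColumn-isTableau m L fb h' eq C) i j j' ik jm hβ j'j jL with j ≟ m
  ... | yes refl = ⊥-elim (αAt-≢β fb i (trans (sym (withColumn-last m fb h' i)) hβ))
  ... | no ne = trans (withColumn-other m fb h' i j' (<⇒≢ (<-≤-trans j'j (s≤s⁻¹ jm))))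
                      (empty-left-of-β C i j j' ik (≤∧≢⇒< (s≤s⁻¹ jm) ne) (trans (sym (withColumn-other m fb h' i j ne)) hβ) j'j jL)
  free-nonempty (withColumn-isTableau m L fb h' eq C) i j ik jm jL hA hB with j ≟ m
  ... | yes refl = λ emp → αAt-live j L fb i eq ik jL
          (λ i' ii' i'k e → hA i' ii' i'k (trans (withColumn-last j fb h' i') e))
          (trans (sym (withColumn-last j fb h' i)) emp)
  ... | no ne = λ emp → free-nonempty C i j ik (≤∧≢⇒< (s≤s⁻¹ jm) ne) jL
          (λ i' ii' i'k e → hA i' ii' i'k (trans (withColumn-other m fb h' i' j ne) e))
          (λ j' jj' j'm e → hB j' jj' (m≤n⇒m≤1+n j'm) (trans (withColumn-other m fb h' i j' (<⇒≢ j'm)) e))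
          (trans (sym (withColumn-other m fb h' i j ne)) emp)

  module _ (m : ℕ) (L : ℕ → ℕ) (b : ℕ) (h' : ℕ → ℕ → Cell)
           (eq : findLast k (live m L) ≡ just b) (C : IsTableau (suc m) (retire L b) h') where
    private
      fj = findLast-just k _ b eq
      bk : b < k
      bk = proj₁ fj
      mLb : m < L b
      mLb = <ᵇ-true⁻¹ (proj₁ (proj₂ fj))
      below : ∀ i → b < i → i < k → live m L i ≡ false
      below = proj₂ (proj₂ fj)
      retiredRow : ∀ j → j < suc m → h' b j ≡ empty
      retiredRow j jm = empty-outside C b j bk jm (subst (_≤ j) (sym (retire-hit L b)) z≤n)
      retire-< : ∀ {i j} → i ≢ b → j < L i → j < retire L b i
      retire-< {i} ne lt = subst (_ <_) (sym (retire-miss L b i ne)) lt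
      retire-≤ : ∀ {i j} → i ≢ b → L i ≤ j → retire L b i ≤ j
      retire-≤ {i} ne lt = subst (_≤ _) (sym (retire-miss L b i ne)) lt
      <-≢ : ∀ {j} → j < suc m → j ≢ m → j < m
      <-≢ jm ne = ≤∧≢⇒< (s≤s⁻¹ jm) ne

    putβ-isTableau : IsTableau (suc m) L (put b m β h')
    empty-outside putβ-isTableau i j ik jm Lij with i ≟ b
    ... | yes refl with j ≟ m
    ...   | yes refl = ⊥-elim (<⇒≱ mLb Lij)
    ...   | no ne = trans (put-otherColumn i m β h' i j ne) (retiredRow j jm)
    empty-outside putβ-isTableau i j ik jm Lij | no ne = trans (put-otherRow b m β h' i j ne) (empty-outside C i j ik jm (retire-≤ ne Lij))
    empty-above-α putβ-isTableau i j i' ik jm hα i'i jL with i ≟ b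
    ... | yes refl with j ≟ m
    ...   | yes refl = ⊥-elim (β≢α (trans (sym (put-hit i j β h')) hα))
    ...   | no ne = ⊥-elim (empty≢α (trans (sym (retiredRow j jm)) (trans (sym (put-otherColumn i m β h' i j ne)) hα)))
    empty-above-α putβ-isTableau i j i' ik jm hα i'i jL | no ne with i' ≟ b
    ... | no ne' = trans (put-otherRow b m β h' i' j ne')
                         (empty-above-α C i j i' ik jm (trans (sym (put-otherRow b m β h' i j ne)) hα) i'i (retire-< ne' jL))
    ... | yes refl with j ≟ m
    ...   | no nej = trans (put-otherColumn i' m β h' i' j nej) (retiredRow j jm)
    ...   | yes refl = ⊥-elim (not-¬ (<ᵇ-true alv) (below i i'i ik))
      where
      hα' : h' i j ≡ α
      hα' = trans (sym (put-otherRow i' j β h' i j ne)) hα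
      alv : j < L i
      alv with j <? retire L i' i
      ... | yes p = subst (j <_) (retire-miss L i' i ne) p
      ... | no np = ⊥-elim (empty≢α (trans (sym (empty-outside C i j ik jm (≮⇒≥ np))) hα'))
    empty-left-of-β putβ-isTableau i j j' ik jm hβ j'j jL with i ≟ b
    ... | yes refl = trans (put-otherColumn i m β h' i j' (<⇒≢ (<-≤-trans j'j (s≤s⁻¹ jm)))) (retiredRow j' (<-trans j'j jm))
    ... | no ne = trans (put-otherRow b m β h' i j' ne)
                        (empty-left-of-β C i j j' ik jm (trans (sym (put-otherRow b m β h' i j ne)) hβ) j'j (retire-< ne jL))
    free-nonempty putβ-isTableau i j ik jm jL hA hB with i ≟ b
    ... | yes refl with j ≟ m
    ...   | yes refl = λ e → β≢empty (trans (sym (put-hit i j β h')) e)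
    ...   | no ne = ⊥-elim (hB m (<-≢ jm ne) ≤-refl (put-hit i m β h'))
    free-nonempty putβ-isTableau i j ik jm jL hA hB | no ne = λ e → free-nonempty C i j ik jm (retire-< ne jL)
        (λ i' ii' i'k e' → hA' i' ii' i'k e')
        (λ j' jj' j'm e' → hB j' jj' j'm (trans (put-otherRow b m β h' i j' ne) e'))
        (trans (sym (put-otherRow b m β h' i j ne)) e)
      where
      hA' : ∀ i' → i < i' → i' < k → h' i' j ≢ α
      hA' i' ii' i'k e' with i' ≟ b
      ... | yes refl = empty≢α (trans (sym (retiredRow j jm)) e')
      ... | no ne' = hA i' ii' i'k (trans (put-otherRow b m β h' i' j ne') e')

  fill-isTableau : ∀ m L p → Fits m L p → IsTableau m L (fill m L p)
  fill-isTableau zero L p ok = record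
    { empty-outside = λ _ _ _ () ; empty-above-α = λ _ _ _ _ () ; empty-left-of-β = λ _ _ _ _ () ; free-nonempty = λ _ _ _ () }
  fill-isTableau (suc m) L (W ∷ p) ok = withColumn-isTableau m L _ _ refl (fill-isTableau m L p ok)
  fill-isTableau (suc m) L (S ∷ p) ok with findLast k (live m L) in eq
  ... | just b = putβ-isTableau m L b _ eq (fill-isTableau (suc m) (retire L b) p ok)

  Agree : ℕ → (ℕ → ℕ → Cell) → (ℕ → ℕ → Cell) → Set
  Agree m h h' = ∀ i j → i < k → j < m → h i j ≡ h' i j

  countS-replicate : ∀ r → countS (replicate r S) ≡ r
  countS-replicate zero = refl
  countS-replicate (suc r) = cong suc (countS-replicate r)

  countW-replicate : ∀ r → countW (replicate r S) ≡ 0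
  countW-replicate zero = refl
  countW-replicate (suc r) = countW-replicate r

  countBelow-retire : ∀ j L b → b < k → j < L b → countBelow k (live j (retire L b)) + 1 ≡ countBelow k (live j L)
  countBelow-retire j L b bk jb = countBelow-flip k _ _ b bk
    (λ i ik ne → cong (j <ᵇ_) (retire-miss L b i ne))
    (trans (cong (j <ᵇ_) (retire-hit L b)) (<ᵇ-false {j} {0} z≤n)) (<ᵇ-true jb)

  isTableau-restrict : ∀ m L h → IsTableau (suc m) L h → (∀ i → i < k → h i m ≢ β) → IsTableau m L h
  empty-outside (isTableau-restrict m L h C nb) i j ik jm = empty-outside C i j ik (m≤n⇒m≤1+n jm)
  empty-above-α (isTableau-restrict m L h C nb) i j i' ik jm = empty-above-α C i j i' ik (m≤n⇒m≤1+n jm)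
  empty-left-of-β (isTableau-restrict m L h C nb) i j j' ik jm = empty-left-of-β C i j j' ik (m≤n⇒m≤1+n jm)
  free-nonempty (isTableau-restrict m L h C nb) i j ik jm jL hA hB = free-nonempty C i j ik (m≤n⇒m≤1+n jm) jL hA hB'
    where
    hB' : ∀ j' → j < j' → j' < suc m → h i j' ≢ β
    hB' j' jj' j'm with j' ≟ m
    ... | yes refl = nb i ik
    ... | no ne = hB j' jj' (≤∧≢⇒< (s≤s⁻¹ j'm) ne)

  Preimage : ℕ → (ℕ → ℕ) → ℕ → (ℕ → ℕ → Cell) → Set
  Preimage m L y h = Σ (List Step) λ p → Fits m L p × countW p ≡ m × countS p + y ≡ k × Agree m (fill m L p) h

  -- y counts the south steps already taken; every row that is still nonempty needs one more.
  Capacity : (ℕ → ℕ) → ℕ → Set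
  Capacity L y = y + countBelow k (live 0 L) ≤ k

  liveRows-retire : ∀ j L b y → b < k → j < L b →
                    countBelow k (live j (retire L b)) + suc y ≡ countBelow k (live j L) + y
  liveRows-retire j L b y bk jb =
    trans (+-suc _ y) (cong (_+ y) (trans (+-comm 1 _) (countBelow-retire j L b bk jb)))

  capacity-retire : ∀ L b y → b < k → 0 < L b → Capacity L y → Capacity (retire L b) (suc y)
  capacity-retire L b y bk pos I = ≤-trans (≤-reflexive shift) I
    where
    shift : suc y + countBelow k (live 0 (retire L b)) ≡ y + countBelow k (live 0 L)
    shift = trans (+-comm (suc y) _) (trans (liveRows-retire 0 L b y bk pos) (+-comm _ y))

  module LastColumn (m : ℕ) (L : ℕ → ℕ) (h : ℕ → ℕ → Cell) (C : IsTableau (suc m) L h) where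

    αColumn-restrict : ∀ fb → (∀ i → i < k → h i m ≡ αAt fb i) → IsTableau m L h
    αColumn-restrict fb col = isTableau-restrict m L h C (λ i ik e → αAt-≢β fb i (trans (sym (col i ik)) e))

    preimage-W : ∀ y → (∀ i → i < k → h i m ≡ αAt (findLast k (live m L)) i) →
                 Preimage m L y h → Preimage (suc m) L y h
    preimage-W y col (p , ok , cw , cs , ag) = W ∷ p , ok , cong suc cw , cs , agree
      where
      agree : Agree (suc m) (fill (suc m) L (W ∷ p)) h
      agree i j ik jm with j ≟ m
      ... | yes refl = trans (withColumn-last j (findLast k (live j L)) (fill j L p) i) (sym (col i ik))
      ... | no ne = trans (withColumn-other m (findLast k (live m L)) (fill m L p) i j ne) (ag i j ik (≤∧≢⇒< (s≤s⁻¹ jm) ne))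

    noLive-column : findLast k (live m L) ≡ nothing → ∀ i → i < k → h i m ≡ αAt (findLast k (live m L)) i
    noLive-column eq i ik = trans (empty-outside C i m ik ≤-refl (<ᵇ-false⁻¹ (findLast-nothing k _ eq i ik)))
                                  (cong (λ fb → αAt fb i) (sym eq))

    module _ (b : ℕ) (eq : findLast k (live m L) ≡ just b) where
      private
        bk : b < k
        bk = proj₁ (findLast-just k _ b eq)
        mLb : m < L b
        mLb = <ᵇ-true⁻¹ (proj₁ (proj₂ (findLast-just k _ b eq)))
        below : ∀ i → b < i → i < k → live m L i ≡ false
        below = proj₂ (proj₂ (findLast-just k _ b eq))
        noα-below : ∀ i → b < i → i < k → h i m ≢ α
        noα-below i bi ik e with m <? L i
        ... | yes p = not-¬ (<ᵇ-true p) (below i bi ik)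
        ... | no np = empty≢α (trans (sym (empty-outside C i m ik ≤-refl (≮⇒≥ np))) e)
        notb : ∀ {i j} → j < retire L b i → i ≢ b
        notb {i} lt refl = <⇒≱ lt (subst (_≤ _) (sym (retire-hit L b)) z≤n)
        unretire : ∀ {i j} → i ≢ b → j < retire L b i → j < L i
        unretire {i} ne = subst (_ <_) (retire-miss L b i ne)

      lowestLive-nonempty : h b m ≢ empty
      lowestLive-nonempty = free-nonempty C b m bk ≤-refl mLb noα-below (λ j' mj' j'm → ⊥-elim (<⇒≱ mj' (s≤s⁻¹ j'm)))

      α-column : h b m ≡ α → ∀ i → i < k → h i m ≡ αAt (findLast k (live m L)) i
      α-column hb i ik = trans (entry i ik) (cong (λ fb → αAt fb i) (sym eq))
        where
        entry : ∀ i → i < k → h i m ≡ αAt (just b) i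
        entry i ik with i ≟ b
        ... | yes refl = trans hb (sym (αAt-hit i))
        ... | no ne with m <? L i
        ...   | no np = trans (empty-outside C i m ik ≤-refl (≮⇒≥ np)) (sym (αAt-miss b i ne))
        ...   | yes p with <-cmp i b
        ...     | tri≈ _ q _ = ⊥-elim (ne q)
        ...     | tri> _ _ bi = ⊥-elim (not-¬ (<ᵇ-true p) (below i bi ik))
        ...     | tri< ib _ _ = trans (empty-above-α C b m i bk ≤-refl hb ib p) (sym (αAt-miss b i ne))

      clearβ-isTableau : h b m ≡ β → IsTableau (suc m) (retire L b) (put b m empty h)
      empty-outside (clearβ-isTableau hb) i j ik jm Lij with i ≟ b
      ... | no ne = trans (put-otherRow b m empty h i j ne) (empty-outside C i j ik jm (subst (_≤ j) (retire-miss L b i ne) Lij))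
      ... | yes refl with j ≟ m
      ...   | yes refl = put-hit i j empty h
      ...   | no nej with j <? L i
      ...     | yes p = trans (put-otherColumn i m empty h i j nej) (empty-left-of-β C i m j ik ≤-refl hb (≤∧≢⇒< (s≤s⁻¹ jm) nej) p)
      ...     | no np = trans (put-otherColumn i m empty h i j nej) (empty-outside C i j ik jm (≮⇒≥ np))
      empty-above-α (clearβ-isTableau hb) i j i' ik jm hα i'i jL =
        trans (put-otherRow b m empty h i' j (notb jL)) (empty-above-α C i j i' ik jm hα' i'i (unretire (notb jL) jL))
        where
        hα' : h i j ≡ α
        hα' with i ≟ b
        ... | no ne = trans (sym (put-otherRow b m empty h i j ne)) hα
        ... | yes refl with j ≟ m
        ...   | yes refl = ⊥-elim (empty≢α (trans (sym (put-hit i j empty h)) hα))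
        ...   | no nej = trans (sym (put-otherColumn i m empty h i j nej)) hα
      empty-left-of-β (clearβ-isTableau hb) i j j' ik jm hβ j'j jL = trans (put-otherRow b m empty h i j' (notb jL))
        (empty-left-of-β C i j j' ik jm (trans (sym (put-otherRow b m empty h i j (notb jL))) hβ) j'j (unretire (notb jL) jL))
      free-nonempty (clearβ-isTableau hb) i j ik jm jL hA hB e = free-nonempty C i j ik jm (unretire (notb jL) jL) hA' hB'
          (trans (sym (put-otherRow b m empty h i j (notb jL))) e)
        where
        hA' : ∀ i' → i < i' → i' < k → h i' j ≢ α
        hA' i' ii' i'k e' with i' ≟ b
        ... | no ne = hA i' ii' i'k (trans (put-otherRow b m empty h i' j ne) e')
        ... | yes refl with j ≟ m
        ...   | yes refl = β≢α (trans (sym hb) e')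
        ...   | no nej = hA i' ii' i'k (trans (put-otherColumn i' m empty h i' j nej) e')
        hB' : ∀ j' → j < j' → j' < suc m → h i j' ≢ β
        hB' j' jj' j'm e' = hB j' jj' j'm (trans (put-otherRow b m empty h i j' (notb jL)) e')

      lowestLive-bounds : b < k × m < L b
      lowestLive-bounds = bk , mLb

      preimage-S : ∀ y → h b m ≡ β → Preimage (suc m) (retire L b) (suc y) (put b m empty h) → Preimage (suc m) L y h
      preimage-S y hb (p , ok , cw , cs , ag) = S ∷ p , subst (FitsS m L p) (sym eq) ok , cw , trans (sym (+-suc _ y)) cs , agree
        where
        h' = fill (suc m) (retire L b) p
        agree : Agree (suc m) (fill (suc m) L (S ∷ p)) h
        agree i j ik jm = trans (cong (λ fb → fillS m L p fb i j) eq) (entry i j ik jm)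
          where
          entry : ∀ i j → i < k → j < suc m → put b m β h' i j ≡ h i j
          entry i j ik jm with i ≟ b
          ... | no ne = trans (put-otherRow b m β h' i j ne) (trans (ag i j ik jm) (put-otherRow b m empty h i j ne))
          ... | yes refl with j ≟ m
          ...   | yes refl = trans (put-hit i j β h') (sym hb)
          ...   | no nej = trans (put-otherColumn i m β h' i j nej) (trans (ag i j ik jm) (put-otherColumn i m empty h i j nej))

  open LastColumn

  -- f, the number of live rows in the last column, drops with every β removed; it makes the
  -- recursion structural.
  mutual
    preimage : ∀ m L y h → IsTableau m L h → Capacity L y → Preimage m L y h
    preimage zero L y h C I = replicate (k ∸ y) S , tt , countW-replicate (k ∸ y) ,
       trans (cong (_+ y) (countS-replicate (k ∸ y))) (m∸n+n≡m (≤-trans (m≤m+n y _) I)) , λ _ _ _ ()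
    preimage (suc m) L y h C I = preimage-column m L y h C I (countBelow k (live m L)) refl

    preimage-column : ∀ m L y h → IsTableau (suc m) L h → Capacity L y →
                      ∀ f → countBelow k (live m L) ≡ f → Preimage (suc m) L y h
    preimage-column m L y h C I f cf with findLast k (live m L) in eq
    ... | nothing = preimage-W m L h C y col (preimage m L y h (αColumn-restrict m L h C (findLast k (live m L)) col) I)
      where col = noLive-column m L h C eq
    ... | just b with h b m in hb
    ...   | empty = ⊥-elim (lowestLive-nonempty m L h C b eq hb)
    ...   | α = preimage-W m L h C y col (preimage m L y h (αColumn-restrict m L h C (findLast k (live m L)) col) I)
      where col = α-column m L h C b eq hb
    ...   | β = preimage-S m L h C b eq y hb (retired f cf)
      where
      bk = proj₁ (lowestLive-bounds m L h C b eq)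
      mLb = proj₂ (lowestLive-bounds m L h C b eq)
      retired : ∀ f → countBelow k (live m L) ≡ f → Preimage (suc m) (retire L b) (suc y) (put b m empty h)
      retired zero cf = ⊥-elim (1+n≢0 (trans (+-comm 1 _) (trans (countBelow-retire m L b bk mLb) cf)))
      retired (suc f) cf = preimage-column m (retire L b) (suc y) _ (clearβ-isTableau m L h C b eq hb)
        (capacity-retire L b y bk (≤-<-trans z≤n mLb) I) f (suc-injective (trans (+-comm 1 _) (trans (countBelow-retire m L b bk mLb) cf)))


  allSouth : ∀ p → Defs.countW p ≡ 0 → p ≡ Data.List.replicate (Defs.countS p) S
  allSouth [] e = refl
  allSouth (S ∷ p) e = cong (S ∷_) (allSouth p e)

  fill-injective : ∀ m L p q → Fits m L p → Fits m L q → Defs.countW p ≡ m → Defs.countW q ≡ m →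
        Defs.countS p ≡ Defs.countS q → Agree m (fill m L p) (fill m L q) → p ≡ q
  fill-injective zero L p q okp okq cwp cwq cs ag = trans (allSouth p cwp) (trans (cong (λ r → Data.List.replicate r S) cs) (sym (allSouth q cwq)))
  fill-injective (suc m) L (W ∷ p) (W ∷ q) okp okq cwp cwq cs ag =
    cong (W ∷_) (fill-injective m L p q okp okq (suc-injective cwp) (suc-injective cwq) cs
      (λ i j ik jm → trans (sym (withColumn-other m (findLast k (live m L)) (fill m L p) i j (<⇒≢ jm)))
         (trans (ag i j ik (m≤n⇒m≤1+n jm)) (withColumn-other m (findLast k (live m L)) (fill m L q) i j (<⇒≢ jm)))))
  fill-injective (suc m) L (S ∷ p) (S ∷ q) okp okq cwp cwq cs ag with findLast k (live m L) in eq
  ... | just b = cong (S ∷_) (fill-injective (suc m) (retire L b) p q okp okq cwp cwq (suc-injective cs) ag')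
    where
    bk : b < k
    bk = proj₁ (findLast-just k _ b eq)
    E : ∀ r → Fits (suc m) (retire L b) r → fill (suc m) (retire L b) r b m ≡ empty
    E r ok = empty-outside (fill-isTableau (suc m) (retire L b) r ok) b m bk ≤-refl (subst (_≤ m) (sym (retire-hit L b)) z≤n)
    ag' : Agree (suc m) (fill (suc m) (retire L b) p) (fill (suc m) (retire L b) q)
    ag' i j ik jm with i ≟ b
    ... | no ne = trans (sym (put-otherRow b m β (fill (suc m) (retire L b) p) i j ne))
                        (trans (ag i j ik jm) (put-otherRow b m β (fill (suc m) (retire L b) q) i j ne))
    ... | yes refl with j ≟ m
    ...   | yes refl = trans (E p okp) (sym (E q okq))
    ...   | no nej = trans (sym (put-otherColumn i m β (fill (suc m) (retire L i) p) i j nej))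
                           (trans (ag i j ik jm) (put-otherColumn i m β (fill (suc m) (retire L i) q) i j nej))
  fill-injective (suc m) L (W ∷ p) (S ∷ q) okp okq cwp cwq cs ag with findLast k (live m L) in eq
  ... | just b = ⊥-elim (α≢β (trans (sym (αAt-hit b)) (trans (sym (withColumn-last m (just b) (fill m L p) b))
         (trans (ag b m (proj₁ (findLast-just k _ b eq)) ≤-refl) (put-hit b m β (fill (suc m) (retire L b) q))))))
  fill-injective (suc m) L (S ∷ p) (W ∷ q) okp okq cwp cwq cs ag with findLast k (live m L) in eq
  ... | just b = ⊥-elim (α≢β (trans (sym (αAt-hit b)) (trans (sym (withColumn-last m (just b) (fill m L q) b))
         (trans (sym (ag b m (proj₁ (findLast-just k _ b eq)) ≤-refl)) (put-hit b m β (fill (suc m) (retire L b) p))))))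

  αFreeColumn : (ℕ → ℕ → Cell) → ℕ → Bool
  αFreeColumn h j = not (anyBelow k (λ i → isα (h i j)))

  βFreeRow : ℕ → (ℕ → ℕ → Cell) → ℕ → Bool
  βFreeRow m h i = not (anyBelow m (λ j → isβ (h i j)))

  αFreeColumns : ℕ → (ℕ → ℕ → Cell) → ℕ
  αFreeColumns m h = countBelow m (αFreeColumn h)

  βFreeRows : ℕ → (ℕ → ℕ → Cell) → ℕ
  βFreeRows m h = countBelow k (βFreeRow m h)

  innerSouthSteps : ℕ → List Step → ℕ
  innerSouthSteps zero p = 0
  innerSouthSteps (suc x) [] = 0
  innerSouthSteps (suc x) (S ∷ p) = suc (innerSouthSteps (suc x) p)
  innerSouthSteps (suc x) (W ∷ p) = innerSouthSteps x p

  mutual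
    deadWestSteps : ℕ → (ℕ → ℕ) → List Step → ℕ
    deadWestSteps zero L p = 0
    deadWestSteps (suc m) L [] = 0
    deadWestSteps (suc m) L (W ∷ p) = indicator (is-nothing (findLast k (live m L))) + deadWestSteps m L p
    deadWestSteps (suc m) L (S ∷ p) = deadWestStepsS m L p (findLast k (live m L))

    deadWestStepsS : ℕ → (ℕ → ℕ) → List Step → Maybe ℕ → ℕ
    deadWestStepsS m L p nothing = 0
    deadWestStepsS m L p (just b) = deadWestSteps (suc m) (retire L b) p

  isβ-αAt : ∀ fb i → isβ (αAt fb i) ≡ false
  isβ-αAt nothing i = refl
  isβ-αAt (just b) i with i ≡ᵇ b
  ... | true = refl
  ... | false = refl

  retiredRow-empty : ∀ m L b p → b < k → Fits (suc m) (retire L b) p →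
                     ∀ j → j < suc m → fill (suc m) (retire L b) p b j ≡ empty
  retiredRow-empty m L b p bk ok j jm =
    empty-outside (fill-isTableau (suc m) (retire L b) p ok) b j bk jm (subst (_≤ j) (sym (retire-hit L b)) z≤n)

  βFreeRow-withColumn : ∀ m fb h i → βFreeRow (suc m) (withColumn m fb h) i ≡ βFreeRow m h i
  βFreeRow-withColumn m fb h i = cong not (begin
      anyBelow (suc m) (λ j → isβ (h' i j))
    ≡⟨ anyBelow-last m _ ⟩
      anyBelow m (λ j → isβ (h' i j)) ∨ isβ (h' i m)
    ≡⟨ cong₂ _∨_ (anyBelow-cong m _ _ (λ j jm → cong isβ (withColumn-other m fb h i j (<⇒≢ jm))))
                 (trans (cong isβ (withColumn-last m fb h i)) (isβ-αAt fb i)) ⟩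
      anyBelow m (λ j → isβ (h i j)) ∨ false
    ≡⟨ ∨-identityʳ _ ⟩
      anyBelow m (λ j → isβ (h i j)) ∎)
    where
    open ≡-Reasoning
    h' = withColumn m fb h

  βFreeRows-putβ : ∀ m b h → b < k → (∀ j → j < suc m → h b j ≡ empty) →
                   βFreeRows (suc m) (put b m β h) + 1 ≡ βFreeRows (suc m) h
  βFreeRows-putβ m b h bk emptyRow = countBelow-flip k _ _ b bk
    (λ i ik ne → cong not (anyBelow-cong (suc m) _ _ (λ j jm → cong isβ (put-otherRow b m β h i j ne))))
    (cong not (anyBelow-true (suc m) (λ j → isβ (put b m β h b j)) m ≤-refl (cong isβ (put-hit b m β h))))
    (cong not (anyBelow-false (suc m) _ (λ j jm → cong isβ (emptyRow j jm))))

  βFreeRows-fill : ∀ m L p → Fits m L p → βFreeRows m (fill m L p) + innerSouthSteps m p ≡ k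
  βFreeRows-fill zero L p ok = trans (+-identityʳ _) (countBelow-true k)
  βFreeRows-fill (suc m) L (W ∷ p) ok =
    trans (cong (_+ innerSouthSteps m p) (countBelow-cong k _ _ (λ i _ → βFreeRow-withColumn m (findLast k (live m L)) (fill m L p) i)))
          (βFreeRows-fill m L p ok)
  βFreeRows-fill (suc m) L (S ∷ p) ok with findLast k (live m L) in eq
  ... | just b = begin
      βFreeRows (suc m) (put b m β h') + suc (innerSouthSteps (suc m) p)
    ≡⟨ sym (+-assoc _ 1 _) ⟩
      βFreeRows (suc m) (put b m β h') + 1 + innerSouthSteps (suc m) p
    ≡⟨ cong (_+ innerSouthSteps (suc m) p) (βFreeRows-putβ m b h' bk (retiredRow-empty m L b p bk ok)) ⟩
      βFreeRows (suc m) h' + innerSouthSteps (suc m) p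
    ≡⟨ βFreeRows-fill (suc m) (retire L b) p ok ⟩
      k ∎
    where
    open ≡-Reasoning
    h' = fill (suc m) (retire L b) p
    bk = proj₁ (findLast-just k _ b eq)

  αFreeColumn-withColumn-last : ∀ m fb h → (∀ b → fb ≡ just b → b < k) →
                                αFreeColumn (withColumn m fb h) m ≡ is-nothing fb
  αFreeColumn-withColumn-last m fb h bound = trans
    (cong not (anyBelow-cong k _ (λ i → isα (αAt fb i)) (λ i ik → cong isα (withColumn-last m fb h i))))
    (column fb bound)
    where
    column : ∀ fb → (∀ b → fb ≡ just b → b < k) → not (anyBelow k (λ i → isα (αAt fb i))) ≡ is-nothing fb
    column nothing _ = cong not (anyBelow-false k _ (λ _ _ → refl))
    column (just b) bound = cong not (anyBelow-true k _ b (bound b refl) (cong isα (αAt-hit b)))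

  αFreeColumn-withColumn-other : ∀ m fb h j → j < m → αFreeColumn (withColumn m fb h) j ≡ αFreeColumn h j
  αFreeColumn-withColumn-other m fb h j jm =
    cong not (anyBelow-cong k _ _ (λ i ik → cong isα (withColumn-other m fb h i j (<⇒≢ jm))))

  αFreeColumn-putβ : ∀ m b h j → j < suc m → h b m ≡ empty → αFreeColumn (put b m β h) j ≡ αFreeColumn h j
  αFreeColumn-putβ m b h j jm hb = cong not (anyBelow-cong k _ _ entry)
    where
    entry : ∀ i → i < k → isα (put b m β h i j) ≡ isα (h i j)
    entry i ik with i ≟ b
    ... | no ne = cong isα (put-otherRow b m β h i j ne)
    ... | yes refl with j ≟ m
    ...   | yes refl = trans (cong isα (put-hit i j β h)) (cong isα (sym hb))
    ...   | no nej = cong isα (put-otherColumn i m β h i j nej)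

  αFreeColumns-fill : ∀ m L p → Fits m L p → αFreeColumns m (fill m L p) ≡ deadWestSteps m L p
  αFreeColumns-fill zero L p ok = refl
  αFreeColumns-fill (suc m) L (W ∷ p) ok = begin
      countBelow (suc m) (αFreeColumn h)
    ≡⟨ countBelow-last m _ ⟩
      countBelow m (αFreeColumn h) + indicator (αFreeColumn h m)
    ≡⟨ +-comm (countBelow m (αFreeColumn h)) _ ⟩
      indicator (αFreeColumn h m) + countBelow m (αFreeColumn h)
    ≡⟨ cong₂ _+_ (cong indicator (αFreeColumn-withColumn-last m fb h0 (λ b e → proj₁ (findLast-just k _ b e))))
                 (countBelow-cong m _ _ (αFreeColumn-withColumn-other m fb h0)) ⟩
      indicator (is-nothing fb) + αFreeColumns m h0
    ≡⟨ cong (indicator (is-nothing fb) +_) (αFreeColumns-fill m L p ok) ⟩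
      indicator (is-nothing fb) + deadWestSteps m L p ∎
    where
    open ≡-Reasoning
    fb = findLast k (live m L)
    h0 = fill m L p
    h = withColumn m fb h0
  αFreeColumns-fill (suc m) L (S ∷ p) ok with findLast k (live m L) in eq
  ... | just b = trans (countBelow-cong (suc m) _ _ (λ j jm → αFreeColumn-putβ m b h' j jm (retiredRow-empty m L b p bk ok m ≤-refl)))
                       (αFreeColumns-fill (suc m) (retire L b) p ok)
    where
    h' = fill (suc m) (retire L b) p
    bk = proj₁ (findLast-just k _ b eq)


module Domination (k : ℕ) (la : Vec ℕ k) where

  height : ℕ → ℕ
  height j = countAbove j (toList la)

  Dominated : ℕ → List Step → List Step → Set
  Dominated d p b = ∀ t → countS (take t p) ≤ d + countS (take t b)

  dominated-[] : ∀ d b → Dominated d [] b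
  dominated-[] d b zero = z≤n
  dominated-[] d b (suc t) = z≤n

  dominated-SS : ∀ d p b → Dominated d (S ∷ p) (S ∷ b) ⇔ Dominated d p b
  dominated-SS d p b = mk⇔
    (λ h t → s≤s⁻¹ (≤-trans (h (suc t)) (≤-reflexive (+-suc d (countS (take t b))))))
    (λ { h zero → z≤n ; h (suc t) → ≤-trans (s≤s (h t)) (≤-reflexive (sym (+-suc d (countS (take t b))))) })

  dominated-SW : ∀ d p b → Dominated (suc d) (S ∷ p) (W ∷ b) ⇔ Dominated d p b
  dominated-SW d p b = mk⇔ (λ h t → s≤s⁻¹ (h (suc t))) (λ { h zero → z≤n ; h (suc t) → s≤s (h t) })

  ¬dominated-SW : ∀ p b → ¬ Dominated 0 (S ∷ p) (W ∷ b)
  ¬dominated-SW p b h with h 1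
  ... | ()

  dominated-WS : ∀ d p b → Dominated d (W ∷ p) (S ∷ b) ⇔ Dominated (suc d) p b
  dominated-WS d p b = mk⇔
    (λ h t → ≤-trans (h (suc t)) (≤-reflexive (+-suc d (countS (take t b)))))
    (λ { h zero → z≤n ; h (suc t) → ≤-trans (h t) (≤-reflexive (sym (+-suc d (countS (take t b))))) })

  dominated-WW : ∀ d p b → Dominated d (W ∷ p) (W ∷ b) ⇔ Dominated d p b
  dominated-WW d p b = mk⇔ (λ h t → h (suc t)) (λ { h zero → z≤n ; h (suc t) → h t })

  -- At column x after y south steps, a south step needs column x − 1 to be taller than y.
  Feasible : ℕ → ℕ → List Step → Set
  Feasible x y [] = ⊤
  Feasible zero y (S ∷ p) = Feasible zero (suc y) p
  Feasible (suc x) y (S ∷ p) = y < height x × Feasible (suc x) (suc y) p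
  Feasible zero y (W ∷ p) = ⊥
  Feasible (suc x) y (W ∷ p) = Feasible x y p

  feasible-S : ∀ x y p → (∀ x' → x ≡ suc x' → y < height x') → Feasible x (suc y) p ⇔ Feasible x y (S ∷ p)
  feasible-S zero y p _ = mk⇔ (λ z → z) (λ z → z)
  feasible-S (suc x') y p below = mk⇔ (below x' refl ,_) proj₂

  <-height : ∀ {y Y x' n} → y ≤ Y → height x' ≡ Y + suc n → y < height x'
  <-height {y} {Y} {x'} {n} yY eq = subst (y <_) (sym eq) (≤-trans (s≤s (≤-trans yY (m≤m+n Y n))) (≤-reflexive (sym (+-suc Y n))))

  ≤-of-≡+ : ∀ {y d Y} → Y ≡ y + d → y ≤ Y
  ≤-of-≡+ {y} {d} e = ≤-trans (m≤m+n y d) (≤-reflexive (sym e))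

  tooManySouthSteps : ∀ {p y Y} → Y ≡ y + 0 → Y + 0 ≡ k → countS (S ∷ p) + y ≡ k → ⊥
  tooManySouthSteps {p} {y} {Y} e2 e3 cs = <-irrefl (sym eq) (s≤s (m≤n+m y (countS p)))
    where eq = trans cs (trans (sym e3) (trans (+-identityʳ Y) (trans e2 (+-identityʳ y))))

  -- The path and the boundary are compared after the same number of steps: the path is at column x
  -- after y south steps, the boundary at column cur after Y south steps with the rows xs still to
  -- come, and d is the lag between them.
  dominated⇔feasible : ∀ p x y d cur Y xs → cur ≡ x + d → Y ≡ y + d → Y + length xs ≡ k → YoungListIn cur xs →
       (∀ j → j < cur → height j ≡ Y + countAbove j xs) → countW p ≡ x → countS p + y ≡ k →
       Dominated d p (boundaryFrom cur xs) ⇔ Feasible x y p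
  dominated⇔feasible [] x y d cur Y xs e1 e2 e3 young inv cw cs = mk⇔ (λ _ → tt) (λ _ → dominated-[] d _)
  dominated⇔feasible (S ∷ p) x y d zero Y [] e1 e2 e3 young inv cw cs =
    ⊥-elim (tooManySouthSteps {p} (trans e2 (cong (y +_) (m+n≡0⇒n≡0 x (sym e1)))) e3 cs)
  dominated⇔feasible (S ∷ p) x y zero (suc c) Y [] e1 e2 e3 young inv cw cs = ⊥-elim (tooManySouthSteps {p} e2 e3 cs)
  dominated⇔feasible (S ∷ p) x y (suc d') (suc c) Y [] e1 e2 e3 young inv cw cs =
    ⇔.trans (dominated-SW d' p _) (⇔.trans IH lift)
    where
    e1' : c ≡ x + d'
    e1' = suc-injective (trans e1 (+-suc x d'))
    IH = dominated⇔feasible p x (suc y) d' c Y [] e1' (trans e2 (+-suc y d')) e3 tt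
           (λ j jc → inv j (m≤n⇒m≤1+n jc)) cw (trans (+-suc _ y) cs)
    lift = feasible-S x y p (λ x' ex → <-height {n = d'} ≤-refl (trans (inv x' (x'<sc x' ex)) (trans (+-identityʳ Y) e2)))
      where
      x'<sc : ∀ x' → x ≡ suc x' → x' < suc c
      x'<sc x' ex = s≤s (≤-trans (m≤n⇒m≤1+n (m≤m+n x' d')) (≤-reflexive (sym (trans e1' (cong (_+ d') ex)))))
  dominated⇔feasible (S ∷ p) x y d cur Y (x1 ∷ xs') e1 e2 e3 (le , young) inv cw cs with x1 ≟ cur
  ... | yes refl rewrite boundaryFrom-S x1 xs' = ⇔.trans (dominated-SS d p _) (⇔.trans IH lift)
    where
    inv' : ∀ j → j < x1 → height j ≡ suc Y + countAbove j xs'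
    inv' j jc = trans (inv j jc) (trans (cong (Y +_) (countAbove-hit j x1 xs' jc)) (+-suc Y _))
    IH = dominated⇔feasible p x (suc y) d x1 (suc Y) xs' e1 (cong suc e2) (trans (sym (+-suc Y _)) e3) young inv' cw (trans (+-suc _ y) cs)
    lift = feasible-S x y p (λ x' ex → <-height (≤-of-≡+ e2) (trans (inv x' (x'< x' ex)) (cong (Y +_) (countAbove-hit x' x1 xs' (x'< x' ex)))))
      where
      x'< : ∀ x' → x ≡ suc x' → x' < x1
      x'< x' ex = ≤-trans (s≤s (m≤m+n x' d)) (≤-reflexive (sym (trans e1 (cong (_+ d) ex))))
  ... | no ne with cur
  ...   | zero = ⊥-elim (ne (n≤0⇒n≡0 le))
  ...   | suc c rewrite boundaryFrom-W c x1 xs' (s≤s⁻¹ (≤∧≢⇒< le ne)) = res d e1 e2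
    where
    x1c : x1 ≤ c
    x1c = s≤s⁻¹ (≤∧≢⇒< le ne)
    heightc : height c ≡ Y
    heightc = trans (inv c ≤-refl) (trans (cong (Y +_) (countAbove-zero c (x1 ∷ xs') (x1c , young))) (+-identityʳ Y))
    res : ∀ d → suc c ≡ x + d → Y ≡ y + d → Dominated d (S ∷ p) (W ∷ boundaryFrom c (x1 ∷ xs')) ⇔ Feasible x y (S ∷ p)
    res zero e1 e2 = mk⇔ (λ h → ⊥-elim (¬dominated-SW p _ h)) (λ N → ⊥-elim (infeasible x (trans (sym (+-identityʳ x)) (sym e1)) N))
      where
      infeasible : ∀ x → x ≡ suc c → Feasible x y (S ∷ p) → ⊥
      infeasible (suc .c) refl (lt , _) = <-irrefl (sym (trans heightc (trans e2 (+-identityʳ y)))) lt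
    res (suc d') e1 e2 = ⇔.trans (dominated-SW d' p _) (⇔.trans IH lift)
      where
      e1' : c ≡ x + d'
      e1' = suc-injective (trans e1 (+-suc x d'))
      IH = dominated⇔feasible p x (suc y) d' c Y (x1 ∷ xs') e1' (trans e2 (+-suc y d')) e3 (x1c , young)
             (λ j jc → inv j (m≤n⇒m≤1+n jc)) cw (trans (+-suc _ y) cs)
      lift = feasible-S x y p (λ x' ex → <-≤-trans (subst (y <_) (sym (trans heightc (trans e2 (+-suc y d')))) (s≤s (m≤m+n y d')))
                                     (countAbove-anti (toList la) (x'≤c x' ex)))
        where
        x'≤c : ∀ x' → x ≡ suc x' → x' ≤ c
        x'≤c x' ex = ≤-trans (m≤n⇒m≤1+n (m≤m+n x' d')) (≤-reflexive (sym (trans e1' (cong (_+ d') ex))))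
  dominated⇔feasible (W ∷ p) zero y d cur Y xs e1 e2 e3 young inv () cs
  dominated⇔feasible (W ∷ p) (suc x') y d zero Y xs () e2 e3 young inv cw cs
  dominated⇔feasible (W ∷ p) (suc x') y d (suc c) Y [] e1 e2 e3 young inv cw cs =
    ⇔.trans (dominated-WW d p _)
      (dominated⇔feasible p x' y d c Y [] (suc-injective e1) e2 e3 tt (λ j jc → inv j (m≤n⇒m≤1+n jc)) (suc-injective cw) cs)
  dominated⇔feasible (W ∷ p) (suc x') y d (suc c) Y (x1 ∷ xs') e1 e2 e3 (le , young) inv cw cs with x1 ≟ suc c
  ... | yes refl rewrite boundaryFrom-S x1 xs' =
    ⇔.trans (dominated-WS d p _)
      (dominated⇔feasible p x' y (suc d) x1 (suc Y) xs' (trans e1 (sym (+-suc x' d))) (trans (cong suc e2) (sym (+-suc y d)))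
         (trans (sym (+-suc Y _)) e3) young inv' (suc-injective cw) cs)
    where
    inv' : ∀ j → j < x1 → height j ≡ suc Y + countAbove j xs'
    inv' j jc = trans (inv j jc) (trans (cong (Y +_) (countAbove-hit j x1 xs' jc)) (+-suc Y _))
  ... | no ne rewrite boundaryFrom-W c x1 xs' (s≤s⁻¹ (≤∧≢⇒< le ne)) =
    ⇔.trans (dominated-WW d p _)
      (dominated⇔feasible p x' y d c Y (x1 ∷ xs') (suc-injective e1) e2 e3 (s≤s⁻¹ (≤∧≢⇒< le ne) , young)
         (λ j jc → inv j (m≤n⇒m≤1+n jc)) (suc-injective cw) cs)


module Invariants (k : ℕ) (la : Vec ℕ k) where

  open Construction k
  open Domination k la

  Invariant : ℕ → (ℕ → ℕ) → ℕ → Set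
  Invariant m L y = (∀ j → j < m → countBelow k (live j L) + y ≡ height j) × Capacity L y

  invariant-retire : ∀ m L y b → findLast k (live m L) ≡ just b → Invariant (suc m) L y → Invariant (suc m) (retire L b) (suc y)
  invariant-retire m L y b eq (heights , cap) =
    (λ j jm → trans (liveRows-retire j L b y bk (≤-<-trans (s≤s⁻¹ jm) mLb)) (heights j jm)) ,
    capacity-retire L b y bk (≤-<-trans z≤n mLb) cap
    where
    bk = proj₁ (findLast-just k _ b eq)
    mLb = <ᵇ-true⁻¹ (proj₁ (proj₂ (findLast-just k _ b eq)))

  invariant-restrict : ∀ m L y → Invariant (suc m) L y → Invariant m L y
  invariant-restrict m L y (heights , cap) = (λ j jm → heights j (m≤n⇒m≤1+n jm)) , cap

  noLive⇒onBoundary : ∀ m L y → Invariant (suc m) L y → findLast k (live m L) ≡ nothing → y ≡ height m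
  noLive⇒onBoundary m L y (heights , _) eq = trans (cong (_+ y) (sym (countBelow-none k _ (findLast-nothing k _ eq)))) (heights m ≤-refl)

  live⇒aboveBoundary : ∀ m L y b → Invariant (suc m) L y → findLast k (live m L) ≡ just b → y < height m
  live⇒aboveBoundary m L y b (heights , _) eq =
    ≤-trans (+-monoˡ-≤ y (countBelow-pos k _ b (proj₁ fj) (proj₁ (proj₂ fj)))) (≤-reflexive (heights m ≤-refl))
    where fj = findLast-just k _ b eq

  feasible⇒fits : ∀ m L y p → Invariant m L y → Feasible m y p → countW p ≡ m → Fits m L p
  feasible⇒fits zero L y p I ns cw = tt
  feasible⇒fits (suc m) L y [] I ns ()
  feasible⇒fits (suc m) L y (W ∷ p) I ns cw = feasible⇒fits m L y p (invariant-restrict m L y I) ns (suc-injective cw)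
  feasible⇒fits (suc m) L y (S ∷ p) I (lt , ns) cw with findLast k (live m L) in eq
  ... | nothing = ⊥-elim (<-irrefl (noLive⇒onBoundary m L y I eq) lt)
  ... | just b = feasible⇒fits (suc m) (retire L b) (suc y) p (invariant-retire m L y b eq I) ns cw

  feasible-westBorder : ∀ y p → countW p ≡ 0 → Feasible 0 y p
  feasible-westBorder y [] cw = tt
  feasible-westBorder y (S ∷ p) cw = feasible-westBorder (suc y) p cw

  fits⇒feasible : ∀ m L y p → Invariant m L y → Fits m L p → countW p ≡ m → Feasible m y p
  fits⇒feasible zero L y p I ok cw = feasible-westBorder y p cw
  fits⇒feasible (suc m) L y (W ∷ p) I ok cw = fits⇒feasible m L y p (invariant-restrict m L y I) ok (suc-injective cw)
  fits⇒feasible (suc m) L y (S ∷ p) I ok cw with findLast k (live m L) in eq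
  ... | just b = live⇒aboveBoundary m L y b I eq , fits⇒feasible (suc m) (retire L b) (suc y) p (invariant-retire m L y b eq I) ok cw

  -- The edge predicates of alphaSteps and betaSteps are pattern-matching lambdas that cannot be
  -- named, so the lemmas below take them as a parameter P described by its values.
  countB-column0 : ∀ (P : Edge → Bool) → (∀ x y → P (S , x , y) ≡ false) →
                   ∀ y p → countW p ≡ 0 → 0 ≡ countB P (edgesFrom 0 y p)
  countB-column0 P hS y [] cw = refl
  countB-column0 P hS y (S ∷ p) cw rewrite hS 0 y = countB-column0 P hS (suc y) p cw

  deadWestSteps≡boundarySteps : ∀ (M : ℕ) (P : Edge → Bool) → (∀ x y → P (S , x , y) ≡ false) →
    (∀ x y → x < M → P (W , suc x , y) ≡ (y ≡ᵇ height x)) →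
    ∀ m L y p → m ≤ M → Fits m L p → Invariant m L y → countW p ≡ m → deadWestSteps m L p ≡ countB P (edgesFrom m y p)
  deadWestSteps≡boundarySteps M P hS hW zero L y p mM ok I cw = countB-column0 P hS y p cw
  deadWestSteps≡boundarySteps M P hS hW (suc m) L y (W ∷ p) mM ok I cw rewrite hW m y mM =
    cong₂ _+_ (cong indicator (noLive⇔onBoundary (findLast k (live m L)) refl))
      (deadWestSteps≡boundarySteps M P hS hW m L y p (≤-trans (n≤1+n m) mM) ok (invariant-restrict m L y I) (suc-injective cw))
    where
    noLive⇔onBoundary : ∀ fb → findLast k (live m L) ≡ fb → is-nothing fb ≡ (y ≡ᵇ height m)
    noLive⇔onBoundary nothing e = sym (≡ᵇ-true (noLive⇒onBoundary m L y I e))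
    noLive⇔onBoundary (just b) e = sym (≡ᵇ-false (<⇒≢ (live⇒aboveBoundary m L y b I e)))
  deadWestSteps≡boundarySteps M P hS hW (suc m) L y (S ∷ p) mM ok I cw with findLast k (live m L) in eq
  ... | just b rewrite hS (suc m) y = deadWestSteps≡boundarySteps M P hS hW (suc m) (retire L b) (suc y) p mM ok (invariant-retire m L y b eq I) cw

  countB-westBorder : ∀ (P : Edge → Bool) → (∀ y → P (S , 0 , y) ≡ true) → (∀ x y → P (W , x , y) ≡ false) →
    ∀ y p → countB P (edgesFrom 0 y p) ≡ countS p
  countB-westBorder P h0 hW y [] = refl
  countB-westBorder P h0 hW y (S ∷ p) rewrite h0 y = cong suc (countB-westBorder P h0 hW (suc y) p)
  countB-westBorder P h0 hW y (W ∷ p) rewrite hW 0 y = countB-westBorder P h0 hW y p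

  betaSteps+innerSouthSteps : ∀ (P : Edge → Bool) → (∀ y → P (S , 0 , y) ≡ true) → (∀ x y → P (S , suc x , y) ≡ false) →
    (∀ x y → P (W , x , y) ≡ false) →
    ∀ x y p → countB P (edgesFrom x y p) + innerSouthSteps x p ≡ countS p
  betaSteps+innerSouthSteps P h0 hS hW zero y p = trans (+-identityʳ _) (countB-westBorder P h0 hW y p)
  betaSteps+innerSouthSteps P h0 hS hW (suc x) y [] = refl
  betaSteps+innerSouthSteps P h0 hS hW (suc x) y (S ∷ p) rewrite hS x y =
    trans (+-suc _ _) (cong suc (betaSteps+innerSouthSteps P h0 hS hW (suc x) (suc y) p))
  betaSteps+innerSouthSteps P h0 hS hW (suc x) y (W ∷ p) rewrite hW (suc x) y = betaSteps+innerSouthSteps P h0 hS hW x y p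

  westEdge-rightOf : ∀ q c y0 x y → c < x → elemEdge (W , x , y) (edgesFrom c y0 q) ≡ false
  westEdge-rightOf [] c y0 x y lt = refl
  westEdge-rightOf (S ∷ q) c y0 x y lt = westEdge-rightOf q c (suc y0) x y lt
  westEdge-rightOf (W ∷ q) c y0 x y lt rewrite ≡ᵇ-false (≢-sym (<⇒≢ lt)) =
    westEdge-rightOf q (c ∸ 1) y0 x y (≤-<-trans (m∸n≤m c 1) lt)

  boundary-westEdge : ∀ xs cur y0 → YoungListIn cur xs → ∀ x y → x < cur →
       elemEdge (W , suc x , y) (edgesFrom cur y0 (boundaryFrom cur xs)) ≡ (y ≡ᵇ (y0 + countAbove x xs))
  boundary-westEdge [] (suc c) y0 _ x y lt with x ≟ c
  ... | yes refl rewrite ≡ᵇ-true {x} {x} refl | westEdge-rightOf (replicate x W) x y0 (suc x) y ≤-refl | +-identityʳ y0 = ∨-identityʳ _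
  ... | no ne rewrite ≡ᵇ-false ne = boundary-westEdge [] c y0 tt x y (≤∧≢⇒< (s≤s⁻¹ lt) ne)
  boundary-westEdge (x1 ∷ xs) cur y0 (le , young) x y lt with x1 ≟ cur
  ... | yes refl rewrite boundaryFrom-S x1 xs = trans (boundary-westEdge xs x1 (suc y0) young x y lt)
    (cong (y ≡ᵇ_) (sym (trans (cong (y0 +_) (countAbove-hit x x1 xs lt)) (+-suc y0 _))))
  ... | no ne with cur
  ...   | zero = ⊥-elim (ne (n≤0⇒n≡0 le))
  ...   | suc c rewrite boundaryFrom-W c x1 xs (s≤s⁻¹ (≤∧≢⇒< le ne)) with x ≟ c
  ...     | yes refl rewrite ≡ᵇ-true {x} {x} refl | westEdge-rightOf (boundaryFrom x (x1 ∷ xs)) x y0 (suc x) y ≤-refl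
                    | countAbove-zero x (x1 ∷ xs) (s≤s⁻¹ (≤∧≢⇒< le ne) , young) | +-identityʳ y0 = ∨-identityʳ _
  ...     | no ne' rewrite ≡ᵇ-false ne' =
    boundary-westEdge (x1 ∷ xs) c y0 (s≤s⁻¹ (≤∧≢⇒< le ne) , young) x y (≤∧≢⇒< (s≤s⁻¹ lt) ne')


rowLength : ∀ {k} → Vec ℕ k → ℕ → ℕ
rowLength [] n = 0
rowLength (x ∷ xs) zero = x
rowLength (x ∷ xs) (suc n) = rowLength xs n

lookup≡rowLength : ∀ {k} (la : Vec ℕ k) (i : Fin k) → lookup la i ≡ rowLength la (toℕ i)
lookup≡rowLength (x ∷ xs) Fin.zero = refl
lookup≡rowLength (x ∷ xs) (Fin.suc i) = lookup≡rowLength xs i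

countBelow-rowLength : ∀ {k} (la : Vec ℕ k) j → countBelow k (λ i → j <ᵇ rowLength la i) ≡ countAbove j (toList la)
countBelow-rowLength [] j = refl
countBelow-rowLength (x ∷ xs) j = cong (indicator (j <ᵇ x) +_) (countBelow-rowLength xs j)

youngIn⇒youngListIn : ∀ {k} m (la : Vec ℕ k) → YoungIn m la → YoungListIn m (toList la)
youngIn⇒youngListIn m [] y = _
youngIn⇒youngListIn m (x ∷ xs) (le , y) = le , youngIn⇒youngListIn x xs y

toFilling : ∀ {k m} → (ℕ → ℕ → Cell) → Filling k m
toFilling h = tabulate (λ i → tabulate (λ j → h (toℕ i) (toℕ j)))

cell-toFilling : ∀ {k m} (h : ℕ → ℕ → Cell) (i : Fin k) (j : Fin m) → cell (toFilling {k} {m} h) i j ≡ h (toℕ i) (toℕ j)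
cell-toFilling h i j = trans (cong (λ r → lookup r j) (lookup∘tabulate _ i)) (lookup∘tabulate _ j)

toFilling-fromℕ< : ∀ {k m} (h : ℕ → ℕ → Cell) i j (ik : i < k) (jm : j < m) →
                   cell (toFilling {k} {m} h) (fromℕ< ik) (fromℕ< jm) ≡ h i j
toFilling-fromℕ< h i j ik jm = trans (cell-toFilling h _ _) (cong₂ h (toℕ-fromℕ< ik) (toℕ-fromℕ< jm))

cellℕ : ∀ {k m} → Filling k m → ℕ → ℕ → Cell
cellℕ {k} {m} F i j with i <? k | j <? m
... | yes p | yes q = cell F (fromℕ< p) (fromℕ< q)
... | _ | _ = empty

cellℕ-toℕ : ∀ {k m} (F : Filling k m) (i : Fin k) (j : Fin m) → cellℕ F (toℕ i) (toℕ j) ≡ cell F i j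
cellℕ-toℕ {k} {m} F i j with toℕ i <? k | toℕ j <? m
... | yes p | yes q = cong₂ (cell F) (fromℕ<-toℕ i p) (fromℕ<-toℕ j q)
... | no np | _ = ⊥-elim (np (toℕ<n i))
... | yes _ | no nq = ⊥-elim (nq (toℕ<n j))

cellℕ-fromℕ< : ∀ {k m} (F : Filling k m) i j (ik : i < k) (jm : j < m) → cellℕ F i j ≡ cell F (fromℕ< ik) (fromℕ< jm)
cellℕ-fromℕ< F i j ik jm =
  trans (cong₂ (cellℕ F) (sym (toℕ-fromℕ< ik)) (sym (toℕ-fromℕ< jm))) (cellℕ-toℕ F (fromℕ< ik) (fromℕ< jm))

toFilling-cellℕ : ∀ {k m} (h : ℕ → ℕ → Cell) (F : Filling k m) →
                  (∀ i j → i < k → j < m → h i j ≡ cellℕ F i j) → toFilling h ≡ F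
toFilling-cellℕ h F agree = begin
    tabulate (λ i → tabulate (λ j → h (toℕ i) (toℕ j)))
  ≡⟨ tabulate-cong (λ i → tabulate-cong (λ j → trans (agree (toℕ i) (toℕ j) (toℕ<n i) (toℕ<n j)) (cellℕ-toℕ F i j))) ⟩
    tabulate (λ i → tabulate (lookup (lookup F i)))
  ≡⟨ tabulate-cong (λ i → tabulate∘lookup (lookup F i)) ⟩
    tabulate (lookup F)
  ≡⟨ tabulate∘lookup F ⟩
    F ∎
  where open ≡-Reasoning

countB-tabulate : ∀ {A : Set} m (f : Fin m → A) (P : A → Bool) (Q : ℕ → Bool) → (∀ j → P (f j) ≡ Q (toℕ j)) →
                  countB P (toList (tabulate f)) ≡ countBelow m Q
countB-tabulate zero f P Q h = refl
countB-tabulate (suc m) f P Q h = cong₂ _+_ (cong indicator (h Fin.zero))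
  (countB-tabulate m (λ j → f (Fin.suc j)) P (λ i → Q (suc i)) (λ j → h (Fin.suc j)))

foldr∨-tabulate : ∀ {A : Set} l (f : Fin l → A) (P : A → Bool) (Q : ℕ → Bool) → (∀ j → P (f j) ≡ Q (toℕ j)) →
                  foldr _∨_ false (toList (map P (tabulate f))) ≡ anyBelow l Q
foldr∨-tabulate zero f P Q h = refl
foldr∨-tabulate (suc l) f P Q h =
  cong₂ _∨_ (h Fin.zero) (foldr∨-tabulate l (λ j → f (Fin.suc j)) P (λ i → Q (suc i)) (λ j → h (Fin.suc j)))

module Bijection (n k : ℕ) (la : Vec ℕ k) (yi : YoungIn (n ∸ k) la) where
  open Construction k
  open Domination k la
  open Invariants k la

  m = n ∸ k
  rows = rowLength la

  lookup-fromℕ< : ∀ i (ik : i < k) → lookup la (fromℕ< ik) ≡ rows i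
  lookup-fromℕ< i ik = trans (lookup≡rowLength la _) (cong rows (toℕ-fromℕ< ik))

  fromFilling-isTableau : (F : Filling k m) → IsCatalanTableau la F → IsTableau m rows (cellℕ F)
  IsTableau.empty-outside (fromFilling-isTableau F (outside , aboveα , leftβ , free)) i j ik jm Lij =
    trans (cellℕ-fromℕ< F i j ik jm)
          (outside (fromℕ< ik) (fromℕ< jm) (λ inY → <⇒≱ (subst₂ _<_ (toℕ-fromℕ< jm) (lookup-fromℕ< i ik) inY) Lij))
  IsTableau.empty-above-α (fromFilling-isTableau F (outside , aboveα , leftβ , free)) i j i' ik jm hα i'i jL =
    trans (cellℕ-fromℕ< F i' j i'k jm) (aboveα (fromℕ< ik) (fromℕ< jm) (trans (sym (cellℕ-fromℕ< F i j ik jm)) hα) (fromℕ< i'k)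
      (subst₂ _<_ (sym (toℕ-fromℕ< i'k)) (sym (toℕ-fromℕ< ik)) i'i)
      (subst₂ _<_ (sym (toℕ-fromℕ< jm)) (sym (lookup-fromℕ< i' i'k)) jL))
    where i'k = <-trans i'i ik
  IsTableau.empty-left-of-β (fromFilling-isTableau F (outside , aboveα , leftβ , free)) i j j' ik jm hβ j'j jL =
    trans (cellℕ-fromℕ< F i j' ik j'm) (leftβ (fromℕ< ik) (fromℕ< jm) (trans (sym (cellℕ-fromℕ< F i j ik jm)) hβ) (fromℕ< j'm)
      (subst₂ _<_ (sym (toℕ-fromℕ< j'm)) (sym (toℕ-fromℕ< jm)) j'j)
      (subst₂ _<_ (sym (toℕ-fromℕ< j'm)) (sym (lookup-fromℕ< i ik)) jL))
    where j'm = <-trans j'j jm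
  IsTableau.free-nonempty (fromFilling-isTableau F (outside , aboveα , leftβ , free)) i j ik jm jL hA hB e =
    free (fromℕ< ik) (fromℕ< jm) (subst₂ _<_ (sym (toℕ-fromℕ< jm)) (sym (lookup-fromℕ< i ik)) jL) hA' hB'
       (trans (sym (cellℕ-fromℕ< F i j ik jm)) e)
    where
    hA' : (i' : Fin k) → toℕ (fromℕ< ik) < toℕ i' → cell F i' (fromℕ< jm) ≢ α
    hA' i' lt e' = hA (toℕ i') (subst (_< toℕ i') (toℕ-fromℕ< ik) lt) (toℕ<n i')
      (trans (trans (cong (cellℕ F (toℕ i')) (sym (toℕ-fromℕ< jm))) (cellℕ-toℕ F i' (fromℕ< jm))) e')
    hB' : (j' : Fin m) → toℕ (fromℕ< jm) < toℕ j' → cell F (fromℕ< ik) j' ≢ β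
    hB' j' lt e' = hB (toℕ j') (subst (_< toℕ j') (toℕ-fromℕ< jm) lt) (toℕ<n j')
      (trans (trans (cong (λ z → cellℕ F z (toℕ j')) (sym (toℕ-fromℕ< ik))) (cellℕ-toℕ F (fromℕ< ik) j')) e')

  toFilling-isTableau : (h : ℕ → ℕ → Cell) → IsTableau m rows h → IsCatalanTableau la (toFilling {k} {m} h)
  toFilling-isTableau h C = outside , aboveα , leftβ , free
    where
    rowLen = lookup≡rowLength la
    outside : (i : Fin k) (j : Fin m) → ¬ InY la i j → cell (toFilling h) i j ≡ empty
    outside i j notY = trans (cell-toFilling h i j)
      (IsTableau.empty-outside C (toℕ i) (toℕ j) (toℕ<n i) (toℕ<n j) (subst (_≤ toℕ j) (rowLen i) (≮⇒≥ notY)))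
    aboveα : (i : Fin k) (j : Fin m) → cell (toFilling h) i j ≡ α →
             (i' : Fin k) → toℕ i' < toℕ i → InY la i' j → cell (toFilling h) i' j ≡ empty
    aboveα i j hα i' lt inY = trans (cell-toFilling h i' j) (IsTableau.empty-above-α C (toℕ i) (toℕ j) (toℕ i') (toℕ<n i) (toℕ<n j)
      (trans (sym (cell-toFilling h i j)) hα) lt (subst (toℕ j <_) (rowLen i') inY))
    leftβ : (i : Fin k) (j : Fin m) → cell (toFilling h) i j ≡ β →
            (j' : Fin m) → toℕ j' < toℕ j → InY la i j' → cell (toFilling h) i j' ≡ empty
    leftβ i j hβ j' lt inY = trans (cell-toFilling h i j') (IsTableau.empty-left-of-β C (toℕ i) (toℕ j) (toℕ j') (toℕ<n i) (toℕ<n j)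
      (trans (sym (cell-toFilling h i j)) hβ) lt (subst (toℕ j' <_) (rowLen i) inY))
    free : (i : Fin k) (j : Fin m) → InY la i j →
           ((i' : Fin k) → toℕ i < toℕ i' → cell (toFilling h) i' j ≢ α) →
           ((j' : Fin m) → toℕ j < toℕ j' → cell (toFilling h) i j' ≢ β) → cell (toFilling h) i j ≢ empty
    free i j inY hA hB e = IsTableau.free-nonempty C (toℕ i) (toℕ j) (toℕ<n i) (toℕ<n j) (subst (toℕ j <_) (rowLen i) inY) hA' hB'
        (trans (sym (cell-toFilling h i j)) e)
      where
      hA' : ∀ i' → toℕ i < i' → i' < k → h i' (toℕ j) ≢ α
      hA' i' lt i'k e' = hA (fromℕ< i'k) (subst (toℕ i <_) (sym (toℕ-fromℕ< i'k)) lt)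
        (trans (cell-toFilling h (fromℕ< i'k) j) (trans (cong (λ z → h z (toℕ j)) (toℕ-fromℕ< i'k)) e'))
      hB' : ∀ j' → toℕ j < j' → j' < m → h (toℕ i) j' ≢ β
      hB' j' lt j'm e' = hB (fromℕ< j'm) (subst (toℕ j <_) (sym (toℕ-fromℕ< j'm)) lt)
        (trans (cell-toFilling h i (fromℕ< j'm)) (trans (cong (h (toℕ i)) (toℕ-fromℕ< j'm)) e'))

  fcol-toFilling : ∀ h → fcol (toFilling {k} {m} h) ≡ αFreeColumns m h
  fcol-toFilling h = countB-tabulate m (λ j → j) _ (αFreeColumn h)
    (λ j → cong not (foldr∨-tabulate k (λ i → i) _ _ (λ i → cong isα (cell-toFilling h i j))))

  frow-toFilling : ∀ h → frow (toFilling {k} {m} h) ≡ βFreeRows m h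
  frow-toFilling h = countB-tabulate k (λ i → i) _ (βFreeRow m h)
    (λ i → cong not (foldr∨-tabulate m (λ j → j) _ _ (λ j → cong isβ (cell-toFilling h i j))))

  invariant-start : Invariant m rows 0
  invariant-start = (λ j jm → trans (+-identityʳ _) (countBelow-rowLength la j)) , countBelow-≤ k _

  youngRows : YoungListIn m (toList la)
  youngRows = youngIn⇒youngListIn m la yi

  catalan⇔feasible : ∀ p → countW p ≡ m → countS p ≡ k →
        (∀ t → countS (take t p) ≤ countS (take t (boundary m la))) ⇔ Feasible m 0 p
  catalan⇔feasible p cw cs = dominated⇔feasible p m 0 0 m 0 (toList la) (sym (+-identityʳ m)) refl (length-toList la) youngRows
    (λ j _ → refl) cw (trans (+-identityʳ _) cs)

  fits : (C : CatalanPath n k la) → Fits m rows (proj₁ C)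
  fits (p , cs , cw , dom) = feasible⇒fits m rows 0 p invariant-start (Equivalence.to (catalan⇔feasible p cw cs) dom) cw

  toTableau : CatalanPath n k la → CatalanTableau n k la
  toTableau C = toFilling (fill m rows (proj₁ C)) , toFilling-isTableau _ (fill-isTableau m rows (proj₁ C) (fits C))

  toTableau-injective : (C C' : CatalanPath n k la) → proj₁ (toTableau C) ≡ proj₁ (toTableau C') → proj₁ C ≡ proj₁ C'
  toTableau-injective C@(p , cs , cw , _) C'@(q , cs' , cw' , _) e =
    fill-injective m rows p q (fits C) (fits C') cw cw' (trans cs (sym cs')) agree
    where
    agree : Agree m (fill m rows p) (fill m rows q)
    agree i j ik jm = begin
      fill m rows p i j                                    ≡⟨ sym (toFilling-fromℕ< (fill m rows p) i j ik jm) ⟩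
      cell (proj₁ (toTableau C)) (fromℕ< ik) (fromℕ< jm)  ≡⟨ cong (λ F → cell F (fromℕ< ik) (fromℕ< jm)) e ⟩
      cell (proj₁ (toTableau C')) (fromℕ< ik) (fromℕ< jm) ≡⟨ toFilling-fromℕ< (fill m rows q) i j ik jm ⟩
      fill m rows q i j                                    ∎
      where open ≡-Reasoning

  toTableau-surjective : (T : CatalanTableau n k la) → ∃ (λ C → proj₁ (toTableau C) ≡ proj₁ T)
  toTableau-surjective (F , isT) with preimage m rows 0 (cellℕ F) (fromFilling-isTableau F isT) (proj₂ invariant-start)
  ... | (p , ok , cw , cs , agree) =
    (p , cs0 , cw , Equivalence.from (catalan⇔feasible p cw cs0) (fits⇒feasible m rows 0 p invariant-start ok cw)) ,
    toFilling-cellℕ (fill m rows p) F agree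
    where
    cs0 : countS p ≡ k
    cs0 = trans (sym (+-identityʳ _)) cs

  alphaSteps≡fcol : (C : CatalanPath n k la) → alphaSteps m la (proj₁ C) ≡ fcol (proj₁ (toTableau C))
  alphaSteps≡fcol C@(p , _ , cw , _) = begin
    alphaSteps m la p              ≡⟨ sym (deadWestSteps≡boundarySteps m _ (λ x y → refl)
                                        (λ x y → boundary-westEdge (toList la) m 0 youngRows x y)
                                        m rows 0 p ≤-refl (fits C) invariant-start cw) ⟩
    deadWestSteps m rows p         ≡⟨ sym (αFreeColumns-fill m rows p (fits C)) ⟩
    αFreeColumns m (fill m rows p) ≡⟨ sym (fcol-toFilling _) ⟩
    fcol (toFilling {k} {m} (fill m rows p)) ∎
    where open ≡-Reasoning

  betaSteps≡frow : (C : CatalanPath n k la) → betaSteps m (proj₁ C) ≡ frow (proj₁ (toTableau C))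
  betaSteps≡frow C@(p , cs , _ , _) = trans (+-cancelʳ-≡ _ _ _ sameTotal) (sym (frow-toFilling _))
    where
    sameTotal : betaSteps m p + innerSouthSteps m p ≡ βFreeRows m (fill m rows p) + innerSouthSteps m p
    sameTotal = trans (betaSteps+innerSouthSteps _ (λ y → refl) (λ x y → refl) (λ x y → refl) m 0 p)
                      (trans cs (sym (βFreeRows-fill m rows p (fits C))))

  toTableau-weight : (C : CatalanPath n k la) → wtPath n k la C ≡ wtTableau n k la (toTableau C)
  toTableau-weight C = cong₂ _,_ (cong (λ a → ℤ.+ n ℤ.- ℤ.+ a) (alphaSteps≡fcol C))
                                 (cong (λ b → ℤ.+ n ℤ.- ℤ.+ b) (betaSteps≡frow C))

lemma1 : (n k : ℕ) → k ≤ n → (la : Vec ℕ k) → YoungIn (n ∸ k) la →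
    Σ (CatalanPath n k la → CatalanTableau n k la) (λ f →
      ((C C' : CatalanPath n k la) → proj₁ (f C) ≡ proj₁ (f C') → proj₁ C ≡ proj₁ C') ×
      ((T : CatalanTableau n k la) → ∃ (λ C → proj₁ (f C) ≡ proj₁ T)) ×
      ((C : CatalanPath n k la) → wtPath n k la C ≡ wtTableau n k la (f C)))
lemma1 n k _ la young = toTableau , toTableau-injective , toTableau-surjective , toTableau-weight
  where open Bijection n k la young
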